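{- In the union-find data structure with union-by-size and path compression (as described in the context), at any time, for any non-root node $p$ and its parent $\textsc{Parent}(p)$ at that time, $\textsc{Size}^{\max}(\textsc{Parent}(p))\ge 2\cdot\textsc{Size}^{\max}(p)$.
   Context: The data structure maintains a rooted forest on $n$ nodes; $\textsc{Parent}(p)$ denotes the current parent of $p$. Initially every node is its own root and has size $1$. At any time, $\textsc{Size}(p)$ is the current number of descendants of $p$, including $p$. A find step on a node $p$: let $p=p_1\to\cdots\to p_k=r$ be the path from $p$ to the root $r$; every node on the path is made a child of $r$. A union step on two roots $r_a\neq r_b$ of different trees: if $\textsc{Size}(r_a)<\textsc{Size}(r_b)$ swap them; then $r_b$ is made a child of $r_a$ and $\textsc{Size}(r_a)\leftarrow \textsc{Size}(r_a)+\textsc{Size}(r_b)$. For a fixed sequence of steps, the max size $\textsc{Size}^{\max}(p)$ is the number of nodes that are a descendant of $p$ (including $p$) at some point of time during the whole sequence. -}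

module Defs where

open import Data.Nat using (ℕ; suc; _+_; _<_; _≤_)
open import Data.Fin using (Fin)
open import Data.Fin.Subset using (Subset; _∈_)
open import Data.Product using (Σ; _×_; ∃; ∃-syntax)
open import Data.Sum using (_⊎_)
open import Relation.Nullary using (¬_)
open import Relation.Binary.PropositionalEquality using (_≡_; _≢_)

-- A node r is a root iff parent r ≡ r.
-- 'size' is the Size field maintained by the algorithm (only read/updated at roots,
-- where it equals the current number of descendants).
record State (n : ℕ) : Set where
  constructor mkState
  field
    parent : Fin n → Fin n
    size   : Fin n → ℕ
open State public

initial : ∀ {n} → State n
initial = mkState (λ p → p) (λ _ → 1)

Root : ∀ {n} → State n → Fin n → Set
Root s r = parent s r ≡ r

data Desc {n : ℕ} (s : State n) : Fin n → Fin n → Set where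
  here : ∀ {p} → Desc s p p
  up   : ∀ {q p} → Desc s (parent s q) p → Desc s q p

FindStep : ∀ {n} → State n → Fin n → State n → Set
FindStep {n} s p s' =
  Σ (Fin n) λ r → Root s r × Desc s p r ×
    ((∀ q → Desc s p q → parent s' q ≡ r) ×
     (∀ q → ¬ Desc s p q → parent s' q ≡ parent s q) ×
     (∀ q → size s' q ≡ size s q))

Link : ∀ {n} → State n → Fin n → Fin n → State n → Set
Link s a b s' =
  parent s' b ≡ a ×
  (∀ q → q ≢ b → parent s' q ≡ parent s q) ×
  size s' a ≡ size s a + size s b ×
  (∀ q → q ≢ a → size s' q ≡ size s q)

UnionStep : ∀ {n} → State n → Fin n → Fin n → State n → Set
UnionStep s ra rb s' =
  Root s ra × Root s rb × ra ≢ rb ×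
  ((size s ra < size s rb × Link s rb ra s') ⊎
   (¬ (size s ra < size s rb) × Link s ra rb s'))

Step : ∀ {n} → State n → State n → Set
Step {n} s s' = (∃[ p ] FindStep s p s') ⊎ (∃[ ra ] ∃[ rb ] UnionStep s ra rb s')

Execution : ∀ {n} → ℕ → (ℕ → State n) → Set
Execution T ss = ss 0 ≡ initial × (∀ i → i < T → Step (ss i) (ss (suc i)))

-- S is exactly the set of nodes that are descendants of x at some time 0..T;
-- so ∣ S ∣ = Size^max(x).
IsMaxDescSet : ∀ {n} → ℕ → (ℕ → State n) → Fin n → Subset n → Set
IsMaxDescSet {n} T ss x S =
  ∀ (q : Fin n) → (q ∈ S → ∃[ t ] (t ≤ T × Desc (ss t) q x))
                × (∃[ t ] (t ≤ T × Desc (ss t) q x) → q ∈ S)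

-- Let t₀ be the step at which p stops being a root; it is a union step linking p below a
-- root a with Size(p) ≤ Size(a).  As p is never a root again, it gains no descendants
-- afterwards, so Size^max(p) = Size(p) at time t₀.  Every later ancestor of p acquired
-- the whole tree of a (at the latest when it became an ancestor of p), so
-- Size^max(Parent(p)) ≥ Size(a) + Size(p) ≥ 2 Size^max(p).
module Submission where

open import Defs
open import Data.Nat using (ℕ; zero; suc; _≤_; _<_; _*_; _+_; _≤′_; ≤′-refl; ≤′-step; _≤?_)
open import Data.Nat.Properties
  using (≤-refl; ≤-trans; <⇒≤; ≮⇒≥; ≰⇒>; m≤n⇒m≤1+n; <-≤-trans; ≤⇒≤′; s≤′s; +-suc; +-identityʳ;
         *-monoʳ-≤; +-monoʳ-≤; module ≤-Reasoning)
open import Data.Fin using (Fin; _≟_)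
open import Data.Fin.Subset using (Subset; ∣_∣; _∈_; _∪_; ⁅_⁆; inside; outside)
open import Data.Fin.Subset.Properties using (x∈p∪q⁻; x∈p∪q⁺; ∣⁅x⁆∣≡1; x∈⁅x⁆; x∈⁅y⁆⇒x≡y; p⊆q⇒∣p∣≤∣q∣)
open import Data.Vec.Base using ([]; _∷_) renaming (here to here∈; there to there∈)
open import Data.Product using (_×_; ∃-syntax; _,_; proj₁; proj₂)
open import Data.Sum using (_⊎_; inj₁; inj₂) renaming (map to map⊎)
open import Data.Empty using (⊥; ⊥-elim)
open import Relation.Nullary using (¬_; Dec; yes; no)
open import Relation.Binary.PropositionalEquality using (_≡_; _≢_; refl; sym; trans; cong; cong₂; subst; subst₂)

∣p∪q∣≡∣p∣+∣q∣ : ∀ {m} (p q : Subset m) → (∀ {y} → y ∈ p → y ∈ q → ⊥) → ∣ p ∪ q ∣ ≡ ∣ p ∣ + ∣ q ∣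
∣p∪q∣≡∣p∣+∣q∣ []            []            _        = refl
∣p∪q∣≡∣p∣+∣q∣ (inside ∷ p)  (inside ∷ q)  disjoint = ⊥-elim (disjoint here∈ here∈)
∣p∪q∣≡∣p∣+∣q∣ (inside ∷ p)  (outside ∷ q) disjoint =
  cong suc (∣p∪q∣≡∣p∣+∣q∣ p q (λ y∈p y∈q → disjoint (there∈ y∈p) (there∈ y∈q)))
∣p∪q∣≡∣p∣+∣q∣ (outside ∷ p) (inside ∷ q)  disjoint =
  trans (cong suc (∣p∪q∣≡∣p∣+∣q∣ p q (λ y∈p y∈q → disjoint (there∈ y∈p) (there∈ y∈q))))
        (sym (+-suc ∣ p ∣ ∣ q ∣))
∣p∪q∣≡∣p∣+∣q∣ (outside ∷ p) (outside ∷ q) disjoint =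
  ∣p∪q∣≡∣p∣+∣q∣ p q (λ y∈p y∈q → disjoint (there∈ y∈p) (there∈ y∈q))

module _ {n} {s : State n} where

  Desc-trans : ∀ {x y z} → Desc s x y → Desc s y z → Desc s x z
  Desc-trans here     y↝z = y↝z
  Desc-trans (up x↝y) y↝z = up (Desc-trans x↝y y↝z)

  Desc-parent : ∀ {y x} → parent s y ≡ x → Desc s y x
  Desc-parent eq = subst (Desc s _) eq (up here)

  Desc-strict : ∀ {p q} → q ≢ p → Desc s p q → Desc s (parent s p) q
  Desc-strict q≢p here      = ⊥-elim (q≢p refl)
  Desc-strict q≢p (up p↝q) = p↝q

  ancestor-of-root : ∀ {r x} → Root s r → Desc s r x → x ≡ r
  ancestor-of-root {r} r-root = go refl
    where
    go : ∀ {y x} → y ≡ r → Desc s y x → x ≡ r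
    go y≡r here      = y≡r
    go y≡r (up y↝x) = go (trans (cong (parent s) y≡r) r-root) y↝x

  Desc-linear : ∀ {y x z} → Desc s y x → Desc s y z → Desc s x z ⊎ Desc s z x
  Desc-linear here     y↝z      = inj₁ y↝z
  Desc-linear (up y↝x) here     = inj₂ (up y↝x)
  Desc-linear (up y↝x) (up y↝z) = Desc-linear y↝x y↝z

  root-unique : ∀ {y x z} → Root s x → Root s z → Desc s y x → Desc s y z → x ≡ z
  root-unique x-root z-root y↝x y↝z with Desc-linear y↝x y↝z
  ... | inj₁ x↝z = sym (ancestor-of-root x-root x↝z)
  ... | inj₂ z↝x = ancestor-of-root z-root z↝x

  Desc-to-root : ∀ {y x r} → Root s r → Desc s y x → Desc s y r → Desc s x r
  Desc-to-root r-root y↝x y↝r with Desc-linear y↝x y↝r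
  ... | inj₁ x↝r = x↝r
  ... | inj₂ r↝x = subst (Desc s _) (ancestor-of-root r-root r↝x) here

  Desc-dec : ∀ {y r} x → Root s r → Desc s y r → Dec (Desc s y x)
  Desc-dec {y} x r-root here with x ≟ y
  ... | yes refl = yes here
  ... | no x≢y   = no (λ y↝x → x≢y (ancestor-of-root r-root y↝x))
  Desc-dec {y} x r-root (up y↝r) with y ≟ x
  ... | yes refl = yes here
  ... | no y≢x with Desc-dec x r-root y↝r
  ...   | yes py↝x = yes (up py↝x)
  ...   | no ¬py↝x = no λ { here → y≢x refl ; (up py↝x) → ¬py↝x py↝x }

Rooted : ∀ {n} → State n → Set
Rooted {n} s = ∀ (y : Fin n) → ∃[ r ] (Root s r × Desc s y r)

record Descendants {n} (s : State n) (r : Fin n) : Set where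
  field
    members  : Subset n
    sound    : ∀ {y} → y ∈ members → Desc s y r
    complete : ∀ {y} → Desc s y r → y ∈ members
    counted  : ∣ members ∣ ≡ size s r

SizesCorrect : ∀ {n} → State n → Set
SizesCorrect {n} s = ∀ {r : Fin n} → Root s r → Descendants s r

WellFormed : ∀ {n} → State n → Set
WellFormed s = Rooted s × SizesCorrect s

initial-wellFormed : ∀ {n} → WellFormed (initial {n})
initial-wellFormed = (λ y → y , refl , here) , singleton
  where
  singleton : SizesCorrect initial
  singleton {r} _ = record
    { members  = ⁅ r ⁆
    ; sound    = λ y∈r → subst (λ z → Desc initial z r) (sym (x∈⁅y⁆⇒x≡y r y∈r)) here
    ; complete = λ y↝r → subst (_∈ ⁅ r ⁆) (ancestor-of-root refl y↝r) (x∈⁅x⁆ r)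
    ; counted  = ∣⁅x⁆∣≡1 r
    }

record Find {n} (s s' : State n) : Set where
  field
    p r       : Fin n
    r-root    : Root s r
    p↝r       : Desc s p r
    on-path   : ∀ q → Desc s p q → parent s' q ≡ r
    off-path  : ∀ q → ¬ Desc s p q → parent s' q ≡ parent s q
    unchanged : ∀ q → size s' q ≡ size s q

record Union {n} (s s' : State n) : Set where
  field
    a b       : Fin n
    a-root    : Root s a
    b-root    : Root s b
    a≢b       : a ≢ b
    b≤a       : size s b ≤ size s a
    b→a       : parent s' b ≡ a
    others    : ∀ q → q ≢ b → parent s' q ≡ parent s q
    merged    : size s' a ≡ size s a + size s b
    unchanged : ∀ q → q ≢ a → size s' q ≡ size s q

Step⇒Find⊎Union : ∀ {n} {s s' : State n} → Step s s' → Find s s' ⊎ Union s s'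
Step⇒Find⊎Union (inj₁ (p , r , r-root , p↝r , on , off , sz)) = inj₁ (record
  { p = p ; r = r ; r-root = r-root ; p↝r = p↝r ; on-path = on ; off-path = off ; unchanged = sz })
Step⇒Find⊎Union (inj₂ (ra , rb , ra-root , rb-root , ra≢rb , inj₁ (ra<rb , b→a , others , merged , sz))) =
  inj₂ (record { a = rb ; b = ra ; a-root = rb-root ; b-root = ra-root ; a≢b = λ eq → ra≢rb (sym eq)
               ; b≤a = <⇒≤ ra<rb ; b→a = b→a ; others = others ; merged = merged ; unchanged = sz })
Step⇒Find⊎Union (inj₂ (ra , rb , ra-root , rb-root , ra≢rb , inj₂ (ra≮rb , b→a , others , merged , sz))) =
  inj₂ (record { a = ra ; b = rb ; a-root = ra-root ; b-root = rb-root ; a≢b = ra≢rb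
               ; b≤a = ≮⇒≥ ra≮rb ; b→a = b→a ; others = others ; merged = merged ; unchanged = sz })

module FindProperties {n} {s s' : State n} (rooted : Rooted s) (F : Find s s') where
  open Find F

  on-path? : ∀ q → Dec (Desc s p q)
  on-path? q = Desc-dec q (proj₁ (proj₂ (rooted p))) (proj₂ (proj₂ (rooted p)))

  Root-preserved : ∀ {x} → Root s x → Root s' x
  Root-preserved {x} x-root with on-path? x
  ... | yes p↝x = trans (on-path x p↝x) (sym (root-unique x-root r-root p↝x p↝r))
  ... | no ¬p↝x = trans (off-path x ¬p↝x) x-root

  Root-reflected : ∀ {x} → Root s' x → Root s x
  Root-reflected {x} x-root' with on-path? x
  ... | yes p↝x = subst (Root s) (trans (sym (on-path x p↝x)) x-root') r-root
  ... | no ¬p↝x = trans (sym (off-path x ¬p↝x)) x-root'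

  Desc-reflected : ∀ {y x} → Desc s' y x → Desc s y x
  Desc-reflected here = here
  Desc-reflected {y} {x} (up py↝x) with on-path? y
  ... | yes p↝y = subst (Desc s y) (sym (ancestor-of-root r-root r↝x)) (Desc-to-root r-root p↝y p↝r)
    where
    r↝x : Desc s r x
    r↝x = subst (λ z → Desc s z x) (on-path y p↝y) (Desc-reflected py↝x)
  ... | no ¬p↝y = up (subst (λ z → Desc s z x) (off-path y ¬p↝y) (Desc-reflected py↝x))

  Desc-preserved : ∀ {y x} → Root s x → Desc s y x → Desc s' y x
  Desc-preserved x-root here = here
  Desc-preserved {y} {x} x-root (up py↝x) with on-path? y
  ... | yes p↝y = Desc-parent (trans (on-path y p↝y) (root-unique r-root x-root p↝r (Desc-trans p↝y (up py↝x))))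
  ... | no ¬p↝y = up (subst (λ z → Desc s' z x) (sym (off-path y ¬p↝y)) (Desc-preserved x-root py↝x))

  wellFormed : SizesCorrect s → WellFormed s'
  wellFormed sizes = rooted' , sizes'
    where
    rooted' : Rooted s'
    rooted' y with rooted y
    ... | r₀ , r₀-root , y↝r₀ = r₀ , Root-preserved r₀-root , Desc-preserved r₀-root y↝r₀

    sizes' : SizesCorrect s'
    sizes' {x} x-root' = record
      { members  = members
      ; sound    = λ y∈ → Desc-preserved x-root (sound y∈)
      ; complete = λ y↝x → complete (Desc-reflected y↝x)
      ; counted  = trans counted (sym (unchanged x))
      }
      where
      x-root : Root s x
      x-root = Root-reflected x-root'
      open Descendants (sizes x-root)

module UnionProperties {n} {s s' : State n} (U : Union s s') where
  open Union U

  Root-preserved : ∀ {x} → Root s x → x ≢ b → Root s' x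
  Root-preserved {x} x-root x≢b = trans (others x x≢b) x-root

  a-root' : Root s' a
  a-root' = Root-preserved a-root a≢b

  Root-reflected : ∀ {x} → Root s' x → Root s x
  Root-reflected {x} x-root' with x ≟ b
  ... | yes refl = ⊥-elim (a≢b (trans (sym b→a) x-root'))
  ... | no x≢b   = trans (sym (others x x≢b)) x-root'

  Desc-preserved : ∀ {y x} → Desc s y x → Desc s' y x
  Desc-preserved here = here
  Desc-preserved {y} {x} (up py↝x) with y ≟ b
  ... | yes refl = subst (Desc s' b) (sym (ancestor-of-root b-root (up py↝x))) here
  ... | no y≢b   = up (subst (λ z → Desc s' z x) (sym (others y y≢b)) (Desc-preserved py↝x))

  b↝a : Desc s' b a
  b↝a = Desc-parent b→a

  Desc-reflected : ∀ {y x} → Desc s' y x → Desc s y x ⊎ (x ≡ a × Desc s y b)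
  Desc-reflected here = inj₁ here
  Desc-reflected {y} {x} (up py↝x) with y ≟ b
  ... | yes refl = inj₂ (ancestor-of-root a-root' (subst (λ z → Desc s' z x) b→a py↝x) , here)
  ... | no y≢b with Desc-reflected py↝x
  ...   | inj₁ py↝x'       = inj₁ (up (subst (λ z → Desc s z x) (others y y≢b) py↝x'))
  ...   | inj₂ (x≡a , py↝b) = inj₂ (x≡a , up (subst (λ z → Desc s z b) (others y y≢b) py↝b))

  merged-descendants : Descendants s a → Descendants s b → Descendants s' a
  merged-descendants Da Db = record
    { members  = members Da ∪ members Db
    ; sound    = sound'
    ; complete = complete'
    ; counted  = trans (∣p∪q∣≡∣p∣+∣q∣ (members Da) (members Db) disjoint)
                       (trans (cong₂ _+_ (counted Da) (counted Db)) (sym merged))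
    }
    where
    open Descendants

    disjoint : ∀ {y} → y ∈ members Da → y ∈ members Db → ⊥
    disjoint y∈a y∈b = a≢b (root-unique a-root b-root (sound Da y∈a) (sound Db y∈b))

    sound' : ∀ {y} → y ∈ members Da ∪ members Db → Desc s' y a
    sound' y∈ with x∈p∪q⁻ (members Da) (members Db) y∈
    ... | inj₁ y∈a = Desc-preserved (sound Da y∈a)
    ... | inj₂ y∈b = Desc-trans (Desc-preserved (sound Db y∈b)) b↝a

    complete' : ∀ {y} → Desc s' y a → y ∈ members Da ∪ members Db
    complete' y↝a with Desc-reflected y↝a
    ... | inj₁ y↝a'     = x∈p∪q⁺ (inj₁ (complete Da y↝a'))
    ... | inj₂ (_ , y↝b) = x∈p∪q⁺ {p = members Da} (inj₂ (complete Db y↝b))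

  wellFormed : WellFormed s → WellFormed s'
  wellFormed (rooted , sizes) = rooted' , sizes'
    where
    rooted' : Rooted s'
    rooted' y with rooted y
    ... | r₀ , r₀-root , y↝r₀ with r₀ ≟ b
    ...   | yes refl = a , a-root' , Desc-trans (Desc-preserved y↝r₀) b↝a
    ...   | no r₀≢b  = r₀ , Root-preserved r₀-root r₀≢b , Desc-preserved y↝r₀

    sizes' : SizesCorrect s'
    sizes' {x} x-root' with x ≟ a
    ... | yes refl = merged-descendants (sizes a-root) (sizes b-root)
    ... | no x≢a   = record
      { members  = members
      ; sound    = λ y∈ → Desc-preserved (sound y∈)
      ; complete = complete'
      ; counted  = trans counted (sym (unchanged x x≢a))
      }
      where
      open Descendants (sizes (Root-reflected x-root'))
      complete' : ∀ {y} → Desc s' y x → y ∈ members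
      complete' y↝x with Desc-reflected y↝x
      ... | inj₁ y↝x'      = complete y↝x'
      ... | inj₂ (x≡a , _) = ⊥-elim (x≢a x≡a)

module StepProperties {n} {s s' : State n} (rooted : Rooted s) (step : Step s s') where

  Root-reflected : ∀ {x} → Root s' x → Root s x
  Root-reflected with Step⇒Find⊎Union step
  ... | inj₁ F = FindProperties.Root-reflected rooted F
  ... | inj₂ U = UnionProperties.Root-reflected U

  Desc-preserved : ∀ {y x} → Root s x → Desc s y x → Desc s' y x
  Desc-preserved with Step⇒Find⊎Union step
  ... | inj₁ F = FindProperties.Desc-preserved rooted F
  ... | inj₂ U = λ _ → UnionProperties.Desc-preserved U

  Desc-reflected : ∀ {y x} → Desc s' y x →
                   Desc s y x ⊎ (Root s' x × ∃[ b ] (Root s b × parent s' b ≡ x × Desc s y b))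
  Desc-reflected y↝x with Step⇒Find⊎Union step
  ... | inj₁ F = inj₁ (FindProperties.Desc-reflected rooted F y↝x)
  ... | inj₂ U with UnionProperties.Desc-reflected U y↝x
  ...   | inj₁ y↝x'         = inj₁ y↝x'
  ...   | inj₂ (refl , y↝b) = inj₂ (UnionProperties.a-root' U , Union.b U , Union.b-root U , Union.b→a U , y↝b)

  became-child : ∀ {p} → Root s p → ¬ Root s' p →
                 ∃[ a ] (Root s a × a ≢ p × size s p ≤ size s a × parent s' p ≡ a)
  became-child {p} p-root ¬p-root' with Step⇒Find⊎Union step
  ... | inj₁ F = ⊥-elim (¬p-root' (FindProperties.Root-preserved rooted F p-root))
  ... | inj₂ U with Union.b U ≟ p
  ...   | yes refl = a , a-root , a≢b , b≤a , b→a
    where open Union U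
  ...   | no b≢p   = ⊥-elim (¬p-root' (UnionProperties.Root-preserved U p-root (λ p≡b → b≢p (sym p≡b))))

Step-wellFormed : ∀ {n} {s s' : State n} → WellFormed s → Step s s' → WellFormed s'
Step-wellFormed (rooted , sizes) step with Step⇒Find⊎Union step
... | inj₁ F = FindProperties.wellFormed rooted F sizes
... | inj₂ U = UnionProperties.wellFormed U (rooted , sizes)

module ExecutionProperties {n} {T : ℕ} {ss : ℕ → State n} (ex : Execution T ss) where

  invariant : (P : State n → Set) → P initial → (∀ {s s'} → P s → Step s s' → P s') →
              ∀ t → t ≤ T → P (ss t)
  invariant P P-initial P-step zero    _   = subst P (sym (proj₁ ex)) P-initial
  invariant P P-initial P-step (suc m) m<T =
    P-step (invariant P P-initial P-step m (<⇒≤ m<T)) (proj₂ ex m m<T)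

  wellFormed : ∀ t → t ≤ T → WellFormed (ss t)
  wellFormed = invariant WellFormed initial-wellFormed Step-wellFormed

  module At (m : ℕ) (m<T : m < T) = StepProperties (proj₁ (wellFormed m (<⇒≤ m<T))) (proj₂ ex m m<T)

  Root-reflected* : ∀ {t t' x} → t ≤′ t' → t' ≤ T → Root (ss t') x → Root (ss t) x
  Root-reflected* ≤′-refl             _   x-root = x-root
  Root-reflected* (≤′-step {m} t≤′m) m<T x-root =
    Root-reflected* t≤′m (<⇒≤ m<T) (At.Root-reflected m m<T x-root)

  never-root-again : ∀ {t t' x} → ¬ Root (ss t) x → t ≤′ t' → t' ≤ T → ¬ Root (ss t') x
  never-root-again ¬x-root t≤′t' t'≤T x-root' = ¬x-root (Root-reflected* t≤′t' t'≤T x-root')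

  Desc-preserved* : ∀ {t t' x y} → t ≤′ t' → t' ≤ T → Root (ss t') x → Desc (ss t) y x → Desc (ss t') y x
  Desc-preserved* ≤′-refl             _   _      y↝x = y↝x
  Desc-preserved* (≤′-step {m} t≤′m) m<T x-root y↝x =
    At.Desc-preserved m m<T x-root-m (Desc-preserved* t≤′m (<⇒≤ m<T) x-root-m y↝x)
    where
    x-root-m : Root (ss m) _
    x-root-m = At.Root-reflected m m<T x-root

  Desc-reflected* : ∀ {t t' x y} → t ≤′ t' → t' ≤ T → ¬ Root (ss (suc t)) x →
                    Desc (ss t') y x → Desc (ss t) y x
  Desc-reflected* ≤′-refl             _   _        y↝x = y↝x
  Desc-reflected* (≤′-step {m} t≤′m) m<T ¬x-root y↝x with At.Desc-reflected m m<T y↝x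
  ... | inj₁ y↝x'       = Desc-reflected* t≤′m (<⇒≤ m<T) ¬x-root y↝x'
  ... | inj₂ (x-root , _) = ⊥-elim (never-root-again ¬x-root (s≤′s t≤′m) m<T x-root)

  last-root-time : ∀ {t x} → ¬ Root (ss t) x → ∃[ t₀ ] (t₀ < t × Root (ss t₀) x × ¬ Root (ss (suc t₀)) x)
  last-root-time {zero}  {x} ¬x-root = ⊥-elim (¬x-root (cong (λ s → parent s x) (proj₁ ex)))
  last-root-time {suc m} {x} ¬x-root with parent (ss m) x ≟ x
  ... | yes x-root = m , ≤-refl , x-root , ¬x-root
  ... | no ¬x-root-m with last-root-time ¬x-root-m
  ...   | t₀ , t₀<m , rest = t₀ , m≤n⇒m≤1+n t₀<m , rest

  -- A node q becomes an ancestor of p only when a root b above p is linked below q,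
  -- and then q inherits b's descendants; b ≠ p because p is no longer a root.
  ancestor-absorbs : ∀ {t₁ t' p q y} → ¬ Root (ss t₁) p → t₁ ≤′ t' → t' ≤ T →
                     q ≢ p → Desc (ss t') p q → Desc (ss t₁) y (parent (ss t₁) p) →
                     ∃[ t'' ] (t'' ≤ t' × Desc (ss t'') y q)
  ancestor-absorbs _ ≤′-refl _ q≢p p↝q y↝ = _ , ≤-refl , Desc-trans y↝ (Desc-strict q≢p p↝q)
  ancestor-absorbs ¬p-root (≤′-step {m} t₁≤′m) m<T q≢p p↝q y↝ with At.Desc-reflected m m<T p↝q
  ... | inj₁ p↝q' with ancestor-absorbs ¬p-root t₁≤′m (<⇒≤ m<T) q≢p p↝q' y↝
  ...   | t'' , t''≤m , y↝q = t'' , m≤n⇒m≤1+n t''≤m , y↝q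
  ancestor-absorbs ¬p-root (≤′-step {m} t₁≤′m) m<T q≢p p↝q y↝ | inj₂ (_ , b , b-root , b→q , p↝b)
    with ancestor-absorbs ¬p-root t₁≤′m (<⇒≤ m<T) b≢p p↝b y↝
    where
    b≢p : b ≢ _
    b≢p refl = never-root-again ¬p-root t₁≤′m (<⇒≤ m<T) b-root
  ... | t'' , t''≤m , y↝b =
    suc m , ≤-refl ,
    Desc-trans (At.Desc-preserved m m<T b-root (Desc-preserved* (≤⇒≤′ t''≤m) (<⇒≤ m<T) b-root y↝b))
               (Desc-parent b→q)

  descendants-frozen : ∀ {t₀ t' x y} → t₀ ≤ T → Root (ss t₀) x → ¬ Root (ss (suc t₀)) x →
                       t' ≤ T → Desc (ss t') y x → Desc (ss t₀) y x
  descendants-frozen {t₀} {t'} t₀≤T x-root ¬x-root t'≤T y↝x with t' ≤? t₀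
  ... | yes t'≤t₀ = Desc-preserved* (≤⇒≤′ t'≤t₀) t₀≤T x-root y↝x
  ... | no t'≰t₀  = Desc-reflected* (≤⇒≤′ (<⇒≤ (≰⇒> t'≰t₀))) t'≤T ¬x-root y↝x

  record LinkedBelow (p : Fin n) (t : ℕ) : Set where
    field
      t₀       : ℕ
      t₀<t     : t₀ < t
      p-root   : Root (ss t₀) p
      ¬p-root-after : ¬ Root (ss (suc t₀)) p
      a        : Fin n
      a-root   : Root (ss t₀) a
      a≢p      : a ≢ p
      p≤a      : size (ss t₀) p ≤ size (ss t₀) a
      p→a      : parent (ss (suc t₀)) p ≡ a

  linked-below : ∀ {t p} → t ≤ T → ¬ Root (ss t) p → LinkedBelow p t
  linked-below t≤T ¬p-root with last-root-time ¬p-root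
  ... | t₀ , t₀<t , p-root , ¬p-root-after with At.became-child t₀ (<-≤-trans t₀<t t≤T) p-root ¬p-root-after
  ...   | a , a-root , a≢p , p≤a , p→a = record
    { t₀ = t₀ ; t₀<t = t₀<t ; p-root = p-root ; ¬p-root-after = ¬p-root-after
    ; a = a ; a-root = a-root ; a≢p = a≢p ; p≤a = p≤a ; p→a = p→a }

  module Linked {t p} (t≤T : t ≤ T) (¬p-root : ¬ Root (ss t) p) where
    open LinkedBelow (linked-below t≤T ¬p-root) public

    t₀<T : t₀ < T
    t₀<T = <-≤-trans t₀<t t≤T

    parent-absorbs : ∀ {y} → Desc (ss t₀) y p ⊎ Desc (ss t₀) y a →
                     ∃[ t'' ] (t'' ≤ t × Desc (ss t'') y (parent (ss t) p))
    parent-absorbs y↝p⊎a = ancestor-absorbs ¬p-root-after (≤⇒≤′ t₀<t) t≤T ¬p-root (up here) (below-parent y↝p⊎a)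
      where
      below-parent : ∀ {y} → Desc (ss t₀) y p ⊎ Desc (ss t₀) y a → Desc (ss (suc t₀)) y (parent (ss (suc t₀)) p)
      below-parent (inj₁ y↝p) = Desc-trans (At.Desc-preserved t₀ t₀<T p-root y↝p) (up here)
      below-parent (inj₂ y↝a) = subst (Desc _ _) (sym p→a) (At.Desc-preserved t₀ t₀<T a-root y↝a)

lemma3 : ∀ {n : ℕ} (T : ℕ) (ss : ℕ → State n) → Execution T ss →
    ∀ (t : ℕ) → t ≤ T → ∀ (p : Fin n) → parent (ss t) p ≢ p →
    ∀ (A B : Subset n) →
    IsMaxDescSet T ss (parent (ss t) p) A → IsMaxDescSet T ss p B →
    2 * ∣ B ∣ ≤ ∣ A ∣
lemma3 T ss ex t t≤T p ¬p-root A B A-max B-max = begin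
  2 * ∣ B ∣      ≤⟨ *-monoʳ-≤ 2 (p⊆q⇒∣p∣≤∣q∣ B⊆P) ⟩
  2 * ∣ P ∣      ≡⟨ cong (∣ P ∣ +_) (+-identityʳ ∣ P ∣) ⟩
  ∣ P ∣ + ∣ P ∣  ≤⟨ +-monoʳ-≤ ∣ P ∣ ∣P∣≤∣Q∣ ⟩
  ∣ P ∣ + ∣ Q ∣  ≡⟨ ∣p∪q∣≡∣p∣+∣q∣ P Q disjoint ⟨
  ∣ P ∪ Q ∣      ≤⟨ p⊆q⇒∣p∣≤∣q∣ P∪Q⊆A ⟩
  ∣ A ∣          ∎
  where
  open ExecutionProperties ex
  open Linked t≤T ¬p-root
  open ≤-Reasoning
  sizes : SizesCorrect (ss t₀)
  sizes = proj₂ (wellFormed t₀ (<⇒≤ t₀<T))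
  open Descendants (sizes p-root) renaming (members to P; sound to P-sound; complete to P-complete; counted to ∣P∣≡)
  open Descendants (sizes a-root) renaming (members to Q; sound to Q-sound; complete to Q-complete; counted to ∣Q∣≡)

  ∣P∣≤∣Q∣ : ∣ P ∣ ≤ ∣ Q ∣
  ∣P∣≤∣Q∣ = subst₂ _≤_ (sym ∣P∣≡) (sym ∣Q∣≡) p≤a

  B⊆P : ∀ {y} → y ∈ B → y ∈ P
  B⊆P y∈B with proj₁ (B-max _) y∈B
  ... | _ , t'≤T , y↝p = P-complete (descendants-frozen (<⇒≤ t₀<T) p-root ¬p-root-after t'≤T y↝p)

  disjoint : ∀ {y} → y ∈ P → y ∈ Q → ⊥
  disjoint y∈P y∈Q = a≢p (root-unique a-root p-root (Q-sound y∈Q) (P-sound y∈P))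

  P∪Q⊆A : ∀ {y} → y ∈ P ∪ Q → y ∈ A
  P∪Q⊆A y∈ with parent-absorbs (map⊎ P-sound Q-sound (x∈p∪q⁻ P Q y∈))
  ... | t'' , t''≤t , y↝q = proj₂ (A-max _) (t'' , ≤-trans t''≤t t≤T , y↝q)
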